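{- For any linear code $\mathcal{C}\subseteq\mathbb{F}_q^n$ of dimension $k\ge1$, \[\eta(\mathcal{C})\ge\left\lceil\frac{q-1}{q^k-1}\cdot|\mathsf{Supp}(\mathcal{C})|\right\rceil.\]
   Context: $\mathsf{Supp}(\mathcal{C})=\bigcup_{\vec{c}\in\mathcal{C}}\{i:c_i\ne0\}$. A set $S\subseteq[n]$ is redundant for $\mathcal{C}$ if $S\subseteq\mathsf{Supp}(\mathcal{C})$ and for every $\vec{c}\in\mathcal{C}$ and all $i,j\in S$, $c_i=0$ iff $c_j=0$. $\eta(\mathcal{C})$ (the repetition number) is the maximal size of a redundant set for $\mathcal{C}$. -}

module Defs where

open import Level using (Level; _⊔_) renaming (suc to lsuc)
open import Algebra.Bundles using (CommutativeRing)
open import Data.Nat using (ℕ; zero; suc; _≤_)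
open import Data.Fin using (Fin)
import Data.Fin as F
open import Data.Fin.Subset using (Subset; _∈_; ∣_∣)
open import Data.Product using (Σ; ∃; _×_; _,_)
open import Relation.Nullary using (¬_; Dec)
open import Relation.Binary.PropositionalEquality using (_≡_)
open import Function using (_⇔_)

-- Equality is assumed decidable (true for every finite field).
record Field (c ℓ : Level) : Set (lsuc (c ⊔ ℓ)) where
  field
    commRing : CommutativeRing c ℓ
  open CommutativeRing commRing public
  field
    0≉1     : ¬ (0# ≈ 1#)
    inverse : ∀ x → ¬ (x ≈ 0#) → Σ Carrier λ y → (x * y) ≈ 1#
    _≟_     : ∀ x y → Dec (x ≈ y)

record FiniteField (c ℓ : Level) (q : ℕ) : Set (lsuc (c ⊔ ℓ)) where
  field
    fld : Field c ℓ
  open Field fld public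
  field
    enum     : Fin q → Carrier
    enum-inj : ∀ i j → enum i ≈ enum j → i ≡ j
    enum-sur : ∀ x → ∃ λ i → enum i ≈ x

module Codes {c ℓ : Level} {q : ℕ} (𝔽 : FiniteField c ℓ q) where
  open FiniteField 𝔽

  Word : ℕ → Set c
  Word n = Fin n → Carrier

  ∑ : ∀ {k} → (Fin k → Carrier) → Carrier
  ∑ {zero}  f = 0#
  ∑ {suc k} f = f F.zero + ∑ (λ i → f (F.suc i))

  lincomb : ∀ {n k} → (Fin k → Carrier) → (Fin k → Word n) → Word n
  lincomb x G j = ∑ (λ i → x i * G i j)

  -- A linear code C ⊆ F_q^n of dimension k, given by a basis
  -- (the rows of a generator matrix): k linearly independent vectors.
  -- C is their F_q-span.
  record LinearCode (n k : ℕ) : Set (c ⊔ ℓ) where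
    field
      basis       : Fin k → Word n
      independent : ∀ (x : Fin k → Carrier) →
                    (∀ j → lincomb x basis j ≈ 0#) → ∀ i → x i ≈ 0#

  _∈C_ : ∀ {n k} → Word n → LinearCode n k → Set (c ⊔ ℓ)
  w ∈C C = ∃ λ (x : Fin _ → Carrier) → ∀ j → w j ≈ lincomb x (LinearCode.basis C) j

  InSupp : ∀ {n k} → LinearCode n k → Fin n → Set (c ⊔ ℓ)
  InSupp C i = ∃ λ w → (w ∈C C) × ¬ (w i ≈ 0#)

  IsSupp : ∀ {n k} → LinearCode n k → Subset n → Set (c ⊔ ℓ)
  IsSupp C T = ∀ i → (i ∈ T) ⇔ InSupp C i

  Redundant : ∀ {n k} → LinearCode n k → Subset n → Set (c ⊔ ℓ)
  Redundant C S =
    (∀ i → i ∈ S → InSupp C i) ×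
    (∀ w → w ∈C C → ∀ i j → i ∈ S → j ∈ S → ((w i ≈ 0#) ⇔ (w j ≈ 0#)))

  IsRepetitionNumber : ∀ {n k} → LinearCode n k → ℕ → Set (c ⊔ ℓ)
  IsRepetitionNumber C m =
    (∃ λ S → Redundant C S × ∣ S ∣ ≡ m) ×
    (∀ S → Redundant C S → ∣ S ∣ ≤ m)

module Submission where

-- Let g₁ , … , gₙ ∈ 𝔽_q^k be the columns of a generator matrix. For y ∈ 𝔽_q^k the coordinates
-- i ∈ Supp(C) with y = a gᵢ for some a ≠ 0 form a redundant set S_y: if a gᵢ = b gⱼ then
-- a cᵢ = b cⱼ for every codeword c. Each pair (i , a) with i ∈ Supp(C) and a ≠ 0 lies over exactly
-- one y ≠ 0, and over a given y there is at most one such pair per coordinate i, hence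
-- (q − 1) |Supp(C)| ≤ Σ_{y ≠ 0} |S_y| ≤ (q^k − 1) η(C).

open import Defs
open import Level using (Level)
open import Data.Nat using (ℕ; zero; suc; _≤_; _∸_; _^_)
open import Data.Fin using (Fin; zero; suc; combine)
open import Data.Fin.Properties using (any?; combine-injective; ¬∀⟶∃¬)
open import Data.Fin.Subset using (Subset; _∈_; ∣_∣; ⁅_⁆; ∁)
open import Data.Fin.Subset.Properties
  using (_∈?_; x∈⁅y⁆⇔x≡y; x∈∁p⇒x∉p; x∉p⇒x∈∁p; ∣∁p∣≡n∸∣p∣; ∣⁅x⁆∣≡1)
open import Data.Product using (∃; _×_; _,_; proj₁; proj₂)
open import Function using (_∘_; _⇔_; mk⇔; Equivalence)
open import Relation.Unary using (Pred; Decidable)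
open import Relation.Nullary using (¬_; Dec; yes; no; does; contradiction)
open import Relation.Nullary.Decidable using (_×-dec_; ¬?)
open import Relation.Binary.PropositionalEquality as ≡ using (_≡_; _≢_)
import Algebra.Properties.Semiring.Sum as SemiringSum
import Algebra.Properties.CommutativeSemigroup as CommutativeSemigroupProperties
import Relation.Binary.Reasoning.Setoid as SetoidReasoning

module Counting where

  open import Data.Nat using (_+_; _*_; z≤n)
  open import Data.Nat.Properties
    using (+-*-semiring; +-mono-≤; *-identityʳ; ≤-reflexive; module ≤-Reasoning)
  open import Data.Fin using (punchIn)
  open import Data.Fin.Properties using (punchInᵢ≢i) renaming (_≟_ to _≟ᶠ_)
  open import Data.Vec using (_∷_; []; tabulate; there)
  open import Data.Bool using (true; false; if_then_else_)
  open import Relation.Binary.PropositionalEquality using (refl; sym; trans; cong; cong₂; module ≡-Reasoning)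
  open SemiringSum +-*-semiring public
    using (sum; sum-syntax)
  open SemiringSum +-*-semiring
    using (∑-comm; sum-remove; sum-cong-≗; sum-replicate-zero; *-distribˡ-sum; *-distribʳ-sum)

  private
    variable
      p r : Level
      m n : ℕ

  𝟙 : {P : Set p} → Dec P → ℕ
  𝟙 d = if does d then 1 else 0

  𝟙-yes : {A : Set p} (a : Dec A) → A → 𝟙 a ≡ 1
  𝟙-yes (yes _) _ = refl
  𝟙-yes (no ¬x) x = contradiction x ¬x

  𝟙-no : {A : Set p} (a : Dec A) → ¬ A → 𝟙 a ≡ 0
  𝟙-no (yes x) ¬x = contradiction x ¬x
  𝟙-no (no _)  _  = refl

  𝟙-× : {A : Set p} {B : Set r} (a : Dec A) (b : Dec B) → 𝟙 (a ×-dec b) ≡ 𝟙 a * 𝟙 b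
  𝟙-× (yes _) (yes _) = refl
  𝟙-× (yes _) (no _)  = refl
  𝟙-× (no _)  (yes _) = refl
  𝟙-× (no _)  (no _)  = refl

  𝟙-cong : {A : Set p} {B : Set r} (a : Dec A) (b : Dec B) → A ⇔ B → 𝟙 a ≡ 𝟙 b
  𝟙-cong (yes _) (yes _) _   = refl
  𝟙-cong (yes x) (no ¬y) A⇔B = contradiction (Equivalence.to A⇔B x) ¬y
  𝟙-cong (no ¬x) (yes y) A⇔B = contradiction (Equivalence.from A⇔B y) ¬x
  𝟙-cong (no _)  (no _)  _   = refl

  count : {P : Pred (Fin n) p} → Decidable P → ℕ
  count P? = ∑[ i < _ ] 𝟙 (P? i)

  ∑-mono-≤ : {f g : Fin n → ℕ} → (∀ i → f i ≤ g i) → sum f ≤ sum g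
  ∑-mono-≤ {zero}  f≤g = z≤n
  ∑-mono-≤ {suc n} f≤g = +-mono-≤ (f≤g zero) (∑-mono-≤ (f≤g ∘ suc))

  ∑-const : ∀ n x → ∑[ i < n ] x ≡ n * x
  ∑-const zero    x = refl
  ∑-const (suc n) x = cong (x +_) (∑-const n x)

  ∑-≤-vanishing : ∀ (f : Fin n → ℕ) (y₀ : Fin n) {η} →
                  f y₀ ≡ 0 → (∀ y → f y ≤ η) → sum f ≤ (n ∸ 1) * η
  ∑-≤-vanishing {suc n} f y₀ {η} fy₀≡0 f≤η = begin
    sum f                           ≡⟨ sum-remove {i = y₀} f ⟩
    f y₀ + sum (f ∘ punchIn y₀)     ≡⟨ cong (_+ sum (f ∘ punchIn y₀)) fy₀≡0 ⟩
    sum (f ∘ punchIn y₀)            ≤⟨ ∑-mono-≤ (f≤η ∘ punchIn y₀) ⟩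
    ∑[ i < n ] η                    ≡⟨ ∑-const n η ⟩
    n * η                           ∎
    where open ≤-Reasoning

  count-cong : {P : Pred (Fin n) p} {Q : Pred (Fin n) r} (P? : Decidable P) (Q? : Decidable Q) →
               (∀ i → P i ⇔ Q i) → count P? ≡ count Q?
  count-cong P? Q? P⇔Q = sum-cong-≗ (λ i → 𝟙-cong (P? i) (Q? i) (P⇔Q i))

  count-none : {P : Pred (Fin n) p} (P? : Decidable P) → (∀ i → ¬ P i) → count P? ≡ 0
  count-none {n} P? ¬P = trans (sum-cong-≗ (λ i → 𝟙-no (P? i) (¬P i))) (sum-replicate-zero n)

  count-unique : {P : Pred (Fin n) p} (P? : Decidable P) {a : Fin n} →
                 P a → (∀ b → P b → b ≡ a) → count P? ≡ 1
  count-unique {suc n} P? {a} Pa unique = begin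
    count P?                                   ≡⟨ sum-remove {i = a} (λ i → 𝟙 (P? i)) ⟩
    𝟙 (P? a) + count (P? ∘ punchIn a)          ≡⟨ cong₂ _+_ (𝟙-yes (P? a) Pa)
                                                     (count-none (P? ∘ punchIn a) (λ i → punchInᵢ≢i a i ∘ unique _)) ⟩
    1                                          ∎
    where open ≡-Reasoning

  count≤𝟙-any : {P : Pred (Fin n) p} (P? : Decidable P) →
                (∀ a b → P a → P b → a ≡ b) → count P? ≤ 𝟙 (any? P?)
  count≤𝟙-any P? unique with any? P?
  ... | yes (a , Pa) = ≤-reflexive (count-unique P? Pa (λ b Pb → unique b a Pb Pa))
  ... | no ∄P        = ≤-reflexive (count-none P? (λ a Pa → ∄P (a , Pa)))

  count-×ʳ : {A : Set p} {Q : Pred (Fin n) r} (a : Dec A) (Q? : Decidable Q) →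
             count (λ i → a ×-dec Q? i) ≡ 𝟙 a * count Q?
  count-×ʳ a Q? = trans (sum-cong-≗ (λ i → 𝟙-× a (Q? i))) (sym (*-distribˡ-sum (𝟙 a) (λ i → 𝟙 (Q? i))))

  count-× : {P : Pred (Fin m) p} {Q : Pred (Fin n) r} (P? : Decidable P) (Q? : Decidable Q) →
            ∑[ i < m ] count (λ j → P? i ×-dec Q? j) ≡ count P? * count Q?
  count-× P? Q? = trans (sum-cong-≗ (λ i → count-×ʳ (P? i) Q?)) (sym (*-distribʳ-sum (count Q?) (λ i → 𝟙 (P? i))))

  count-≡ : (x : Fin n) → count (x ≟ᶠ_) ≡ 1
  count-≡ x = count-unique (x ≟ᶠ_) refl (λ _ x≡b → sym x≡b)

  toSubset : {P : Pred (Fin n) p} → Decidable P → Subset n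
  toSubset P? = tabulate (does ∘ P?)

  ∈-toSubset : {P : Pred (Fin n) p} (P? : Decidable P) {i : Fin n} → i ∈ toSubset P? → P i
  ∈-toSubset P? {zero} i∈ with P? zero | i∈
  ... | yes Pi | _ = Pi
  ... | no _   | ()
  ∈-toSubset P? {suc i} (there i∈) = ∈-toSubset (P? ∘ suc) i∈

  ∣toSubset∣≡count : {P : Pred (Fin n) p} (P? : Decidable P) → ∣ toSubset P? ∣ ≡ count P?
  ∣toSubset∣≡count {zero}  P? = refl
  ∣toSubset∣≡count {suc n} P? with P? zero
  ... | yes _ = cong suc (∣toSubset∣≡count (P? ∘ suc))
  ... | no _  = ∣toSubset∣≡count (P? ∘ suc)

  ∣p∣≡count-∈ : (S : Subset n) → ∣ S ∣ ≡ count (_∈? S)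
  ∣p∣≡count-∈ []            = refl
  ∣p∣≡count-∈ (true  ∷ S) = cong suc (∣p∣≡count-∈ S)
  ∣p∣≡count-∈ (false ∷ S) = ∣p∣≡count-∈ S

  module FibreCounting {n q M : ℕ} {P : Fin n → Fin q → Set p}
                       (P? : ∀ i → Decidable (P i)) (φ : Fin n → Fin q → Fin M) where

    Over : Fin M → Fin n → Fin q → Set p
    Over y i a = P i a × φ i a ≡ y

    over? : ∀ y i → Decidable (Over y i)
    over? y i a = P? i a ×-dec (φ i a ≟ᶠ y)

    fibre : Fin M → Subset n
    fibre y = toSubset (λ i → any? (over? y i))

    ∈-fibre : ∀ {y i} → i ∈ fibre y → ∃ (Over y i)
    ∈-fibre {y} = ∈-toSubset (λ i → any? (over? y i))

    -- Double counting the pairs (i , a) with P i a through their images under φ.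
    count-pairs-≤ : (∀ i a b → P i a → P i b → φ i a ≡ φ i b → a ≡ b) →
               (y₀ : Fin M) → (∀ i a → P i a → φ i a ≢ y₀) →
               ∀ {η} → (∀ y → ∣ fibre y ∣ ≤ η) →
               ∑[ i < n ] count (P? i) ≤ (M ∸ 1) * η
    count-pairs-≤ φ-injective y₀ φ-avoids {η} ∣fibre∣≤η = begin
      ∑[ i < n ] count (P? i)                           ≡⟨ sum-cong-≗ (λ i → sum-cong-≗ (count-images i)) ⟩
      ∑[ i < n ] ∑[ a < q ] count (λ y → over? y i a)   ≡⟨ sum-cong-≗ (λ i → ∑-comm (λ a y → 𝟙 (over? y i a))) ⟩
      ∑[ i < n ] ∑[ y < M ] count (over? y i)           ≡⟨ ∑-comm (λ i y → count (over? y i)) ⟩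
      ∑[ y < M ] ∑[ i < n ] count (over? y i)           ≤⟨ ∑-≤-vanishing _ y₀ nothing-over-y₀ ∑-over≤η ⟩
      (M ∸ 1) * η                                       ∎
      where
      open ≤-Reasoning

      count-images : ∀ i a → 𝟙 (P? i a) ≡ count (λ y → over? y i a)
      count-images i a = sym (begin-equality
        count (λ y → over? y i a)          ≡⟨ count-×ʳ (P? i a) (φ i a ≟ᶠ_) ⟩
        𝟙 (P? i a) * count (φ i a ≟ᶠ_)     ≡⟨ cong (𝟙 (P? i a) *_) (count-≡ (φ i a)) ⟩
        𝟙 (P? i a) * 1                     ≡⟨ *-identityʳ _ ⟩
        𝟙 (P? i a)                         ∎)

      nothing-over-y₀ : ∑[ i < n ] count (over? y₀ i) ≡ 0
      nothing-over-y₀ = trans (sum-cong-≗ (λ i → count-none (over? y₀ i) (λ a (Pia , φia≡y₀) → φ-avoids i a Pia φia≡y₀)))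
                              (sum-replicate-zero n)

      ∑-over≤η : ∀ y → ∑[ i < n ] count (over? y i) ≤ η
      ∑-over≤η y = begin
        ∑[ i < n ] count (over? y i)        ≤⟨ ∑-mono-≤ (λ i → count≤𝟙-any (over? y i) (λ a b (Pia , φia≡y) (Pib , φib≡y) →
                                                  φ-injective i a b Pia Pib (trans φia≡y (sym φib≡y)))) ⟩
        count (λ i → any? (over? y i))      ≡⟨ sym (∣toSubset∣≡count (λ i → any? (over? y i))) ⟩
        ∣ fibre y ∣                         ≤⟨ ∣fibre∣≤η y ⟩
        η                                   ∎

open Counting

module FieldFacts {c ℓ : Level} {q : ℕ} (𝔽 : FiniteField c ℓ q) where

  open FiniteField 𝔽 hiding (zero)
  open Codes 𝔽
  module 𝔽∑ = SemiringSum semiring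

  *-cancelˡ : ∀ {a x y} → a ≉ 0# → a * x ≈ a * y → x ≈ y
  *-cancelˡ {a} {x} {y} a≉0 ax≈ay with inverse a a≉0
  ... | a⁻¹ , aa⁻¹≈1 = begin
    x                ≈⟨ sym (*-identityˡ x) ⟩
    1# * x           ≈⟨ *-congʳ (trans (sym aa⁻¹≈1) (*-comm a a⁻¹)) ⟩
    (a⁻¹ * a) * x    ≈⟨ *-assoc a⁻¹ a x ⟩
    a⁻¹ * (a * x)    ≈⟨ *-congˡ ax≈ay ⟩
    a⁻¹ * (a * y)    ≈⟨ sym (*-assoc a⁻¹ a y) ⟩
    (a⁻¹ * a) * y    ≈⟨ *-congʳ (trans (*-comm a⁻¹ a) aa⁻¹≈1) ⟩
    1# * y           ≈⟨ *-identityˡ y ⟩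
    y                ∎
    where open SetoidReasoning setoid

  x*y≈0⇒y≈0 : ∀ {x y} → x ≉ 0# → x * y ≈ 0# → y ≈ 0#
  x*y≈0⇒y≈0 {x} x≉0 xy≈0 = *-cancelˡ x≉0 (trans xy≈0 (sym (zeroʳ x)))

  index : Carrier → Fin q
  index x = proj₁ (enum-sur x)

  index-injective : ∀ {x y} → index x ≡ index y → x ≈ y
  index-injective {x} {y} eq =
    trans (sym (proj₂ (enum-sur x))) (trans (reflexive (≡.cong enum eq)) (proj₂ (enum-sur y)))

  enum≈⇔≡index : ∀ {a x} → enum a ≈ x ⇔ a ≡ index x
  enum≈⇔≡index {a} {x} = mk⇔ (λ a≈x → enum-inj a (index x) (trans a≈x (sym (proj₂ (enum-sur x)))))
                              (λ { ≡.refl → proj₂ (enum-sur x) })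

  nonzero? : Decidable (λ a → enum a ≉ 0#)
  nonzero? a = ¬? (enum a ≟ 0#)

  count-nonzero : count nonzero? ≡ q ∸ 1
  count-nonzero = begin
    count nonzero?               ≡⟨ count-cong nonzero? (_∈? ∁ ⁅ a₀ ⁆) nonzero⇔∈∁⁅a₀⁆ ⟩
    count (_∈? ∁ ⁅ a₀ ⁆)         ≡⟨ ∣p∣≡count-∈ (∁ ⁅ a₀ ⁆) ⟨
    ∣ ∁ ⁅ a₀ ⁆ ∣                 ≡⟨ ∣∁p∣≡n∸∣p∣ ⁅ a₀ ⁆ ⟩
    q ∸ ∣ ⁅ a₀ ⁆ ∣               ≡⟨ ≡.cong (q ∸_) (∣⁅x⁆∣≡1 a₀) ⟩
    q ∸ 1                        ∎
    where
    open ≡.≡-Reasoning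
    a₀ : Fin q
    a₀ = index 0#
    nonzero⇔∈∁⁅a₀⁆ : ∀ a → (enum a ≉ 0#) ⇔ (a ∈ ∁ ⁅ a₀ ⁆)
    nonzero⇔∈∁⁅a₀⁆ a = mk⇔
      (λ a≉0 → x∉p⇒x∈∁p (a≉0 ∘ Equivalence.from enum≈⇔≡index ∘ Equivalence.to x∈⁅y⁆⇔x≡y))
      (λ a∈∁ → x∈∁p⇒x∉p a∈∁ ∘ Equivalence.from x∈⁅y⁆⇔x≡y ∘ Equivalence.to enum≈⇔≡index)

  encode : ∀ {k} → Word k → Fin (q ^ k)
  encode {zero}  _ = zero
  encode {suc k} u = combine (index (u zero)) (encode (u ∘ suc))

  encode-injective : ∀ {k} {u v : Word k} → encode u ≡ encode v → ∀ l → u l ≈ v l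
  encode-injective {suc k} {u} {v} eq zero    =
    index-injective (proj₁ (combine-injective (index (u zero)) _ (index (v zero)) _ eq))
  encode-injective {suc k} {u} {v} eq (suc l) =
    encode-injective (proj₂ (combine-injective (index (u zero)) _ (index (v zero)) _ eq)) l

  infix 7 _·_
  _·_ : ∀ {k} → Word k → Word k → Carrier
  x · g = 𝔽∑.sum (λ l → x l * g l)

  ∑≡sum : ∀ {k} (f : Word k) → ∑ f ≡ 𝔽∑.sum f
  ∑≡sum {zero}  f = ≡.refl
  ∑≡sum {suc k} f = ≡.cong (f zero +_) (∑≡sum (f ∘ suc))

  ·-congˡ : ∀ {k} (x : Word k) {g h : Word k} → (∀ l → g l ≈ h l) → x · g ≈ x · h
  ·-congˡ x g≈h = 𝔽∑.sum-cong-≋ (λ l → *-congˡ (g≈h l))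

  ·-zeroʳ : ∀ {k} (x : Word k) {g : Word k} → (∀ l → g l ≈ 0#) → x · g ≈ 0#
  ·-zeroʳ {k} x g≈0 =
    trans (𝔽∑.sum-cong-≋ (λ l → trans (*-congˡ (g≈0 l)) (zeroʳ (x l)))) (𝔽∑.sum-replicate-zero k)

  ·-scaleʳ : ∀ {k} (x : Word k) a (g : Word k) → x · (λ l → a * g l) ≈ a * (x · g)
  ·-scaleʳ x a g =
    trans (𝔽∑.sum-cong-≋ (λ l → x∙yz≈y∙xz (x l) a (g l))) (sym (𝔽∑.*-distribˡ-sum a (λ l → x l * g l)))
    where open CommutativeSemigroupProperties *-commutativeSemigroup using (x∙yz≈y∙xz)

  module Fibres {n k} (C : LinearCode n k) {T : Subset n} (supp : IsSupp C T) where

    open LinearCode C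

    column : Fin n → Word k
    column i l = basis l i

    coordinate≈· : ∀ {w} → w ∈C C → ∃ λ x → ∀ i → w i ≈ x · column i
    coordinate≈· (x , w≈xG) = x , λ i → trans (w≈xG i) (reflexive (∑≡sum (λ l → x l * column i l)))

    column-nonzero : ∀ {i} → i ∈ T → ∃ λ l → column i l ≉ 0#
    column-nonzero {i} i∈T with Equivalence.to (supp i) i∈T
    ... | w , w∈C , wᵢ≉0 with coordinate≈· w∈C
    ...   | x , w≈x·G =
      ¬∀⟶∃¬ k _ (λ l → column i l ≟ 0#) (λ column≈0 → wᵢ≉0 (trans (w≈x·G i) (·-zeroʳ x column≈0)))

    scaled-coordinates : ∀ {a b i j} → (∀ l → a * column i l ≈ b * column j l) →
                         ∀ {w} → w ∈C C → a * w i ≈ b * w j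
    scaled-coordinates {a} {b} {i} {j} aGᵢ≈bGⱼ w∈C with coordinate≈· w∈C
    ... | x , w≈x·G = begin
      a * _                           ≈⟨ *-congˡ (w≈x·G i) ⟩
      a * (x · column i)              ≈⟨ ·-scaleʳ x a (column i) ⟨
      x · (λ l → a * column i l)      ≈⟨ ·-congˡ x aGᵢ≈bGⱼ ⟩
      x · (λ l → b * column j l)      ≈⟨ ·-scaleʳ x b (column j) ⟩
      b * (x · column j)              ≈⟨ *-congˡ (w≈x·G j) ⟨
      b * _                           ∎
      where open SetoidReasoning setoid

    Admissible : Fin n → Fin q → Set ℓ
    Admissible i a = i ∈ T × enum a ≉ 0#

    admissible? : ∀ i → Decidable (Admissible i)
    admissible? i a = (i ∈? T) ×-dec nonzero? a

    φ : Fin n → Fin q → Fin (q ^ k)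
    φ i a = encode (λ l → enum a * column i l)

    φ-injective : ∀ i a b → Admissible i a → Admissible i b → φ i a ≡ φ i b → a ≡ b
    φ-injective i a b (i∈T , _) _ φa≡φb with column-nonzero i∈T
    ... | l , Gᵢₗ≉0 = enum-inj a b (*-cancelˡ Gᵢₗ≉0
      (trans (*-comm _ _) (trans (encode-injective φa≡φb l) (*-comm _ _))))

    origin : Fin (q ^ k)
    origin = encode {k} (λ _ → 0#)

    φ-nonzero : ∀ i a → Admissible i a → φ i a ≢ origin
    φ-nonzero i a (i∈T , a≉0) φa≡0 with column-nonzero i∈T
    ... | l , Gᵢₗ≉0 = Gᵢₗ≉0 (x*y≈0⇒y≈0 a≉0 (encode-injective φa≡0 l))

    open FibreCounting admissible? φ public using (fibre; ∈-fibre; count-pairs-≤)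

    fibre-redundant : ∀ y → Redundant C (fibre y)
    fibre-redundant y = in-support , λ w w∈C i j i∈ j∈ → mk⇔ (transfer w∈C i∈ j∈) (transfer w∈C j∈ i∈)
      where
      in-support : ∀ i → i ∈ fibre y → InSupp C i
      in-support i i∈ with ∈-fibre i∈
      ... | _ , (i∈T , _) , _ = Equivalence.to (supp i) i∈T

      transfer : ∀ {w i j} → w ∈C C → i ∈ fibre y → j ∈ fibre y → w i ≈ 0# → w j ≈ 0#
      transfer {w} {i} {j} w∈C i∈ j∈ wᵢ≈0 with ∈-fibre i∈ | ∈-fibre j∈
      ... | a , _ , φia≡y | b , (_ , b≉0) , φjb≡y =
        x*y≈0⇒y≈0 b≉0 (trans (sym (scaled-coordinates aGᵢ≈bGⱼ w∈C)) (trans (*-congˡ wᵢ≈0) (zeroʳ _)))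
        where
        aGᵢ≈bGⱼ : ∀ l → enum a * column i l ≈ enum b * column j l
        aGᵢ≈bGⱼ = encode-injective (≡.trans φia≡y (≡.sym φjb≡y))

-- Imported only now, since in FieldFacts _*_ and *-comm refer to the field.
open import Data.Nat using (_*_)
open import Data.Nat.Properties using (*-comm; module ≤-Reasoning)

mainTheorem11 : ∀ {c ℓ : Level} {q : ℕ} (𝔽 : FiniteField c ℓ q) →
    let open Codes 𝔽 in
    ∀ {n k : ℕ} → 1 ≤ k → (C : LinearCode n k) →
    (T : Subset n) → IsSupp C T →
    (η : ℕ) → IsRepetitionNumber C η →
    (q ∸ 1) * ∣ T ∣ ≤ (q ^ k ∸ 1) * η
mainTheorem11 {q = q} 𝔽 {n} {k} _ C T supp η (_ , maximal) = begin
  (q ∸ 1) * ∣ T ∣                   ≡⟨ *-comm (q ∸ 1) ∣ T ∣ ⟩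
  ∣ T ∣ * (q ∸ 1)                   ≡⟨ ≡.cong₂ _*_ (∣p∣≡count-∈ T) (≡.sym count-nonzero) ⟩
  count (_∈? T) * count nonzero?    ≡⟨ count-× (_∈? T) nonzero? ⟨
  ∑[ i < n ] count (admissible? i)  ≤⟨ count-pairs-≤ φ-injective origin φ-nonzero
                                         (λ y → maximal (fibre y) (fibre-redundant y)) ⟩
  (q ^ k ∸ 1) * η                   ∎
  where
  open ≤-Reasoning
  open FieldFacts 𝔽
  open Fibres C supp
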